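{- Let $\mathcal{A}$ be a $k$-uniform family, $t$ a positive integer, $\tau\ge 1$, and let $\mathcal{F}\subset\mathcal{A}$ be $\tau$-homogeneous. Then for every $\alpha\in(0,1/(2k)]$ there exists a subfamily $\mathcal{G}\subset\mathcal{F}$ such that (1) $|\mathcal{G}|\ge(1-2\alpha k)|\mathcal{F}|$; (2) for every set $P$ with $|P|\le t-1$, if $\mathcal{G}(P)$ is non-empty then $\mathcal{F}(P)$ is $\alpha(\tau/\alpha)^t$-homogeneous (as a subfamily of $\mathcal{A}(P)$).
   Context: $\mathcal{G}(X)=\{G\setminus X:X\subset G\in\mathcal{G}\}$. A family $\mathcal{F}\subset\mathcal{B}$ is $\tau$-homogeneous (as a subfamily of $\mathcal{B}$) if $\frac{|\mathcal{F}(X)|}{|\mathcal{B}(X)|}\le\tau^{|X|}\frac{|\mathcal{F}|}{|\mathcal{B}|}$ for every set $X$ with $\mathcal{B}(X)\ne\emptyset$; by default $\mathcal{B}=\mathcal{A}$.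
   Formalization: The parameters τ and α, and every homogeneity parameter, range over the rationals. -}

module Defs where

open import Data.Bool using (Bool; true; false; _∧_)
open import Data.Bool.Properties using () renaming (_≟_ to _≟ᵇ_)
open import Data.Nat using (ℕ; zero; suc)
open import Data.Integer using (+_)
open import Data.Rational using (ℚ; _/_; _*_; 1ℚ; 0ℚ; _÷_; NonZero; Positive; _<_; positive)
open import Data.Rational.Properties using (pos⇒nonZero)
open import Data.List using (List; []; _∷_; map; _++_; filter; length)
open import Data.Bool.ListAction using (any)
open import Data.Vec using ([]; _∷_)
open import Data.Vec.Properties using (≡-dec)
open import Data.Fin.Subset using (Subset; inside; outside; _⊆_; _─_)
open import Data.Fin.Subset.Properties using (_⊆?_)
open import Relation.Nullary using (does)
open import Relation.Binary.PropositionalEquality using (_≡_)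
open import Data.Product using (∃)

allSubsets : (n : ℕ) → List (Subset n)
allSubsets zero = [] ∷ []
allSubsets (suc n) = map (inside ∷_) (allSubsets n) ++ map (outside ∷_) (allSubsets n)

Family : ℕ → Set
Family n = Subset n → Bool

∣_∣ᶠ : ∀ {n} → Family n → ℕ
∣ F ∣ᶠ = length (filter (λ S → F S ≡? true) (allSubsets _))
  where
  _≡?_ = _≟ᵇ_

_⊑_ : ∀ {n} → Family n → Family n → Set
G ⊑ F = ∀ S → G S ≡ true → F S ≡ true

NonemptyF : ∀ {n} → Family n → Set
NonemptyF F = ∃ λ S → F S ≡ true

Uniform : ∀ {n} → ℕ → Family n → Set
Uniform k F = ∀ S → F S ≡ true → Data.Fin.Subset.∣ S ∣ ≡ k
  where import Data.Fin.Subset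

-- The link  F(X) = { G ∖ X : X ⊆ G ∈ F }.
link : ∀ {n} → Family n → Subset n → Family n
link {n} F X S =
  any (λ G → F G ∧ does (X ⊆? G) ∧ does (≡-dec _≟ᵇ_ (G ─ X) S)) (allSubsets n)

-- Rational quotient of naturals a / b (the value for b = 0 is never used,
-- since the homogeneity definition only divides by non-empty families).
_÷ℕ_ : ℕ → ℕ → ℚ
a ÷ℕ zero = 0ℚ
a ÷ℕ suc b = (+ a) / suc b

fromℕ : ℕ → ℚ
fromℕ a = (+ a) / 1

_^ℚ_ : ℚ → ℕ → ℚ
p ^ℚ zero = 1ℚ
p ^ℚ suc m = p * (p ^ℚ m)

Homogeneous : ∀ {n} → ℚ → Family n → Family n → Set
Homogeneous {n} τ B F =
  ∀ (X : Subset n) → NonemptyF (link B X) →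
    (∣ link F X ∣ᶠ ÷ℕ ∣ link B X ∣ᶠ) Data.Rational.≤
      ((τ ^ℚ Data.Fin.Subset.∣ X ∣) * (∣ F ∣ᶠ ÷ℕ ∣ B ∣ᶠ))
  where import Data.Rational; import Data.Fin.Subset

homParam : (τ α : ℚ) → 0ℚ < α → ℕ → ℚ
homParam τ α α>0 t = α * (_÷_ τ α {{pos⇒nonZero α {{positive α>0}}}} ^ℚ t)

{-# OPTIONS --safe #-}
-- Call P bad if |P| ≤ t − 1 and the relative density |F(P)|/|A(P)| is below α^|P| |F|/|A|,
-- and let 𝒢 (`cleaned`) consist of the members of F that contain no bad set.  The empty set is
-- never bad, so a union bound and double counting over pairs P ⊆ S ∈ A give
--   |F ∖ 𝒢| ≤ Σ_{P bad} |F(P)| < (|F|/|A|) Σ_{P ≠ ∅} α^|P| |A(P)| = |F| ((1+α)^k − 1) ≤ 2αk |F|.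
-- If 𝒢(P) ≠ ∅ then P is not bad, and for X disjoint from P homogeneity of F gives
--   |F(P)(X)|/|A(P)(X)| = |F(P∪X)|/|A(P∪X)| ≤ τ^(|P|+|X|) |F|/|A| ≤ τ^(|P|+|X|) α^(−|P|) |F(P)|/|A(P)|,
-- which is at most (α (τ/α)^t)^|X| |F(P)|/|A(P)| because |P| + |X| ≤ t |X| and τ/α ≥ 1.
module Submission where

open import Defs
open import Data.Bool using (Bool; true; false; not; _∧_; _∨_)
import Data.Bool.Properties as Bool
open import Data.Bool.ListAction using (any)
open import Data.Empty using (⊥-elim)
open import Data.Fin.Subset using (Subset; inside; outside; ⊥; ∣_∣; _∪_; _─_; _⊆_)
open import Data.Fin.Subset.Properties using (_⊆?_; anySubset?; q⊆p∪q; ∣q∣≤∣p∪q∣; ∪-assoc; ∪-comm; ∪-identityʳ)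
open import Data.Integer as ℤ using (+_)
import Data.Integer.Properties as ℤₚ
open import Data.List using (List; []; _∷_; _++_; map; filter; length)
open import Data.List.Properties using (filter-++; length-++)
open import Data.Nat as ℕ using (ℕ; zero; suc; _≤_; _∸_; _+_)
import Data.Nat.Properties as ℕₚ
open import Data.Product using (Σ; ∃; _×_; _,_)
open import Data.Rational using (ℚ; 0ℚ; 1ℚ; _<_; _*_; _-_; -_; _÷_; 1/_; NonZero; toℚᵘ; nonNegative; positive)
  renaming (_≤_ to _≤ℚ_; _+_ to _+ℚ_)
open import Data.Rational.Properties
open import Data.Rational.Solver using (module +-*-Solver)
import Data.Rational.Unnormalised as ℚᵘ
import Data.Rational.Unnormalised.Properties as ℚᵘₚ
open import Data.Vec using ([]; _∷_)
open import Data.Vec.Properties using (≡-dec)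
open import Relation.Binary.PropositionalEquality
open import Relation.Nullary using (Dec; does; yes; no; ¬_)
open import Relation.Nullary.Decidable using (_×-dec_; dec-true)
open import Relation.Unary using (Decidable)

open +-*-Solver using (solve; _:+_; _:*_; _:-_; _:=_; con)

0≤1 : 0ℚ ≤ℚ 1ℚ
0≤1 = <⇒≤ (positive⁻¹ 1ℚ)

p≤p+q : ∀ p {q} → 0ℚ ≤ℚ q → p ≤ℚ p +ℚ q
p≤p+q p 0≤q = ≤-trans (≤-reflexive (sym (+-identityʳ p))) (+-monoʳ-≤ p 0≤q)

*-nonNeg : ∀ {p q} → 0ℚ ≤ℚ p → 0ℚ ≤ℚ q → 0ℚ ≤ℚ p * q
*-nonNeg {p} {q} 0≤p 0≤q =
  nonNegative⁻¹ (p * q) {{nonNeg*nonNeg⇒nonNeg p {{nonNegative 0≤p}} q {{nonNegative 0≤q}}}}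

*-monoˡ-≤ : ∀ {r p q} → 0ℚ ≤ℚ r → p ≤ℚ q → r * p ≤ℚ r * q
*-monoˡ-≤ {r} 0≤r = *-monoˡ-≤-nonNeg r {{nonNegative 0≤r}}

*-monoʳ-≤ : ∀ {r p q} → 0ℚ ≤ℚ r → p ≤ℚ q → p * r ≤ℚ q * r
*-monoʳ-≤ {r} 0≤r = *-monoʳ-≤-nonNeg r {{nonNegative 0≤r}}

fromℕ-+ : ∀ a b → fromℕ (a + b) ≡ fromℕ a +ℚ fromℕ b
fromℕ-+ a b = toℚᵘ-injective (begin
  toℚᵘ (fromℕ (a + b))                         ≈⟨ toℚᵘ-fromℚᵘ (ℚᵘ.mkℚᵘ (+ (a + b)) 0) ⟩
  ℚᵘ.mkℚᵘ (+ (a + b)) 0                        ≈⟨ ℚᵘ.*≡* (cong (ℤ._* + 1) (trans (ℤₚ.pos-+ a b)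
                                                    (sym (cong₂ ℤ._+_ (ℤₚ.*-identityʳ (+ a)) (ℤₚ.*-identityʳ (+ b)))))) ⟩
  ℚᵘ.mkℚᵘ (+ a) 0 ℚᵘ.+ ℚᵘ.mkℚᵘ (+ b) 0         ≈⟨ ℚᵘₚ.+-cong (toℚᵘ-fromℚᵘ (ℚᵘ.mkℚᵘ (+ a) 0)) (toℚᵘ-fromℚᵘ (ℚᵘ.mkℚᵘ (+ b) 0)) ⟨
  toℚᵘ (fromℕ a) ℚᵘ.+ toℚᵘ (fromℕ b)           ≈⟨ toℚᵘ-homo-+ (fromℕ a) (fromℕ b) ⟨
  toℚᵘ (fromℕ a +ℚ fromℕ b)                    ∎)
  where open ℚᵘₚ.≃-Reasoning

fromℕ-nonNeg : ∀ a → 0ℚ ≤ℚ fromℕ a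
fromℕ-nonNeg a = nonNegative⁻¹ (fromℕ a) {{normalize-nonNeg a 1}}

fromℕ-mono : ∀ {a b} → a ≤ b → fromℕ a ≤ℚ fromℕ b
fromℕ-mono {a} a≤b with ℕₚ.m≤n⇒∃[o]m+o≡n a≤b
... | d , refl = ≤-trans (p≤p+q (fromℕ a) (fromℕ-nonNeg d)) (≤-reflexive (sym (fromℕ-+ a d)))

÷ℕ-nonNeg : ∀ a b → 0ℚ ≤ℚ a ÷ℕ b
÷ℕ-nonNeg a zero    = ≤-refl
÷ℕ-nonNeg a (suc b) = nonNegative⁻¹ (a ÷ℕ suc b) {{normalize-nonNeg a (suc b)}}

-- The hypothesis a ≤ b only matters for b = 0, where a ÷ℕ 0 is the junk value 0.
÷ℕ-* : ∀ {a b} → a ≤ b → (a ÷ℕ b) * fromℕ b ≡ fromℕ a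
÷ℕ-* {b = zero} ℕ.z≤n = refl
÷ℕ-* {a} {suc b} _ = toℚᵘ-injective (begin
  toℚᵘ ((a ÷ℕ suc b) * fromℕ (suc b))
    ≈⟨ toℚᵘ-homo-* (a ÷ℕ suc b) (fromℕ (suc b)) ⟩
  toℚᵘ (a ÷ℕ suc b) ℚᵘ.* toℚᵘ (fromℕ (suc b))
    ≈⟨ ℚᵘₚ.*-cong (toℚᵘ-fromℚᵘ (ℚᵘ.mkℚᵘ (+ a) b)) (toℚᵘ-fromℚᵘ (ℚᵘ.mkℚᵘ (+ suc b) 0)) ⟩
  ℚᵘ.mkℚᵘ (+ a) b ℚᵘ.* ℚᵘ.mkℚᵘ (+ suc b) 0
    ≈⟨ ℚᵘ.*≡* (trans (ℤₚ.*-identityʳ (+ a ℤ.* + suc b))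
                     (cong (λ m → + a ℤ.* + m) (sym (ℕₚ.*-identityʳ (suc b))))) ⟩
  ℚᵘ.mkℚᵘ (+ a) 0
    ≈⟨ toℚᵘ-fromℚᵘ (ℚᵘ.mkℚᵘ (+ a) 0) ⟨
  toℚᵘ (fromℕ a) ∎)
  where open ℚᵘₚ.≃-Reasoning

^ℚ-nonNeg : ∀ {x} m → 0ℚ ≤ℚ x → 0ℚ ≤ℚ x ^ℚ m
^ℚ-nonNeg zero    0≤x = 0≤1
^ℚ-nonNeg (suc m) 0≤x = *-nonNeg 0≤x (^ℚ-nonNeg m 0≤x)

^ℚ-distribˡ-+-* : ∀ x m n → x ^ℚ (m + n) ≡ x ^ℚ m * x ^ℚ n
^ℚ-distribˡ-+-* x zero    n = sym (*-identityˡ (x ^ℚ n))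
^ℚ-distribˡ-+-* x (suc m) n =
  trans (cong (x *_) (^ℚ-distribˡ-+-* x m n)) (sym (*-assoc x (x ^ℚ m) (x ^ℚ n)))

^ℚ-distribʳ-* : ∀ x y m → (x * y) ^ℚ m ≡ x ^ℚ m * y ^ℚ m
^ℚ-distribʳ-* x y zero    = refl
^ℚ-distribʳ-* x y (suc m) =
  trans (cong ((x * y) *_) (^ℚ-distribʳ-* x y m)) (interchange x y (x ^ℚ m) (y ^ℚ m))
  where
  interchange : ∀ a b c d → (a * b) * (c * d) ≡ (a * c) * (b * d)
  interchange = solve 4 (λ a b c d → (a :* b) :* (c :* d) := (a :* c) :* (b :* d)) refl

^ℚ-*-assoc : ∀ x m n → (x ^ℚ m) ^ℚ n ≡ x ^ℚ (m ℕ.* n)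
^ℚ-*-assoc x m zero    = cong (x ^ℚ_) (sym (ℕₚ.*-zeroʳ m))
^ℚ-*-assoc x m (suc n) = begin
  x ^ℚ m * (x ^ℚ m) ^ℚ n       ≡⟨ cong (x ^ℚ m *_) (^ℚ-*-assoc x m n) ⟩
  x ^ℚ m * x ^ℚ (m ℕ.* n)      ≡⟨ ^ℚ-distribˡ-+-* x m (m ℕ.* n) ⟨
  x ^ℚ (m + m ℕ.* n)           ≡⟨ cong (x ^ℚ_) (ℕₚ.*-suc m n) ⟨
  x ^ℚ (m ℕ.* suc n)           ∎
  where open ≡-Reasoning

^ℚ-monoʳ-≤ : ∀ {x m n} → 1ℚ ≤ℚ x → m ≤ n → x ^ℚ m ≤ℚ x ^ℚ n
^ℚ-monoʳ-≤ {n = zero}      1≤x ℕ.z≤n = ≤-refl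
^ℚ-monoʳ-≤ {x} {n = suc n} 1≤x ℕ.z≤n = begin
  1ℚ          ≤⟨ 1≤x ⟩
  x           ≡⟨ *-identityʳ x ⟨
  x * 1ℚ      ≤⟨ *-monoˡ-≤ 0≤x (^ℚ-monoʳ-≤ 1≤x (ℕ.z≤n {n})) ⟩
  x * x ^ℚ n  ∎
  where
  open ≤-Reasoning
  0≤x : 0ℚ ≤ℚ x
  0≤x = ≤-trans 0≤1 1≤x
^ℚ-monoʳ-≤ {x} 1≤x (ℕ.s≤s m≤n) =
  *-monoˡ-≤ (≤-trans 0≤1 1≤x) (^ℚ-monoʳ-≤ 1≤x m≤n)

[1+x]^k*[1-x*k]≤1 : ∀ {x} k → 0ℚ ≤ℚ x → (1ℚ +ℚ x) ^ℚ k * (1ℚ - x * fromℕ k) ≤ℚ 1ℚ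
[1+x]^k*[1-x*k]≤1 {x} zero 0≤x = ≤-reflexive (eq x)
  where
  eq : ∀ x → 1ℚ * (1ℚ - x * 0ℚ) ≡ 1ℚ
  eq = solve 1 (λ x → con 1ℚ :* (con 1ℚ :- x :* con 0ℚ) := con 1ℚ) refl
[1+x]^k*[1-x*k]≤1 {x} (suc k) 0≤x = begin
  (1ℚ +ℚ x) ^ℚ suc k * (1ℚ - x * fromℕ (suc k))
    ≤⟨ p≤p+q _ slack≥0 ⟩
  (1ℚ +ℚ x) ^ℚ suc k * (1ℚ - x * fromℕ (suc k)) +ℚ slack
    ≡⟨ cong (λ K → (1ℚ +ℚ x) ^ℚ suc k * (1ℚ - x * K) +ℚ slack) (fromℕ-+ 1 k) ⟩
  (1ℚ +ℚ x) ^ℚ suc k * (1ℚ - x * (1ℚ +ℚ fromℕ k)) +ℚ slack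
    ≡⟨ expand x ((1ℚ +ℚ x) ^ℚ k) (fromℕ k) ⟩
  (1ℚ +ℚ x) ^ℚ k * (1ℚ - x * fromℕ k)
    ≤⟨ [1+x]^k*[1-x*k]≤1 k 0≤x ⟩
  1ℚ ∎
  where
  open ≤-Reasoning
  slack : ℚ
  slack = (1ℚ +ℚ x) ^ℚ k * ((x * x) * (1ℚ +ℚ fromℕ k))
  slack≥0 : 0ℚ ≤ℚ slack
  slack≥0 = *-nonNeg (^ℚ-nonNeg k (≤-trans 0≤1 (p≤p+q 1ℚ 0≤x)))
                     (*-nonNeg (*-nonNeg 0≤x 0≤x) (≤-trans 0≤1 (p≤p+q 1ℚ (fromℕ-nonNeg k))))
  expand : ∀ x P K → ((1ℚ +ℚ x) * P) * (1ℚ - x * (1ℚ +ℚ K)) +ℚ P * ((x * x) * (1ℚ +ℚ K)) ≡ P * (1ℚ - x * K)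
  expand = solve 3 (λ x P K → ((con 1ℚ :+ x) :* P) :* (con 1ℚ :- x :* (con 1ℚ :+ K)) :+ P :* ((x :* x) :* (con 1ℚ :+ K))
                            := P :* (con 1ℚ :- x :* K)) refl

-- Divide the previous bound by 1 − xk, using (1 + 2xk)(1 − xk) = 1 + xk(1 − 2xk) ≥ 1.
[1+x]^k≤1+x*[k+k] : ∀ {x} k → 0ℚ ≤ℚ x → x * fromℕ (k + k) ≤ℚ 1ℚ → (1ℚ +ℚ x) ^ℚ k ≤ℚ 1ℚ +ℚ x * fromℕ (k + k)
[1+x]^k≤1+x*[k+k] {x} k 0≤x 2xk≤1 rewrite fromℕ-+ k k =
  *-cancelʳ-≤-pos c {{positive 0<c}} (begin
    (1ℚ +ℚ x) ^ℚ k * c                          ≤⟨ [1+x]^k*[1-x*k]≤1 k 0≤x ⟩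
    1ℚ                                          ≤⟨ p≤p+q 1ℚ (*-nonNeg (*-nonNeg 0≤x (fromℕ-nonNeg k)) 0≤1-2xk) ⟩
    1ℚ +ℚ (x * K) * (1ℚ - x * (K +ℚ K))         ≡⟨ factor x K ⟩
    (1ℚ +ℚ x * (K +ℚ K)) * c                    ∎)
  where
  open ≤-Reasoning
  K c : ℚ
  K = fromℕ k
  c = 1ℚ - x * K
  0≤1-2xk : 0ℚ ≤ℚ 1ℚ - x * (K +ℚ K)
  0≤1-2xk = ≤-trans (≤-reflexive (sym (+-inverseʳ (x * (K +ℚ K))))) (+-monoˡ-≤ (- (x * (K +ℚ K))) 2xk≤1)
  factor : ∀ x K → 1ℚ +ℚ (x * K) * (1ℚ - x * (K +ℚ K)) ≡ (1ℚ +ℚ x * (K +ℚ K)) * (1ℚ - x * K)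
  factor = solve 2 (λ x K → con 1ℚ :+ (x :* K) :* (con 1ℚ :- x :* (K :+ K))
                           := (con 1ℚ :+ x :* (K :+ K)) :* (con 1ℚ :- x :* K)) refl
  1≤c+c : 1ℚ ≤ℚ c +ℚ c
  1≤c+c = ≤-trans (p≤p+q 1ℚ 0≤1-2xk) (≤-reflexive (twice x K))
    where
    twice : ∀ x K → 1ℚ +ℚ (1ℚ - x * (K +ℚ K)) ≡ (1ℚ - x * K) +ℚ (1ℚ - x * K)
    twice = solve 2 (λ x K → con 1ℚ :+ (con 1ℚ :- x :* (K :+ K)) := (con 1ℚ :- x :* K) :+ (con 1ℚ :- x :* K)) refl
  0<c : 0ℚ < c
  0<c = ≰⇒> (λ c≤0 → <-irrefl refl (<-≤-trans (positive⁻¹ 1ℚ) (≤-trans 1≤c+c (+-mono-≤ {c} {0ℚ} c≤0 c≤0))))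

[1-c]*[g+d]≤g : ∀ {g d c} → d ≤ℚ c * (g +ℚ d) → (1ℚ - c) * (g +ℚ d) ≤ℚ g
[1-c]*[g+d]≤g {g} {d} {c} d≤c[g+d] = begin
  (1ℚ - c) * (g +ℚ d)          ≡⟨ expand g d c ⟩
  g +ℚ (d - c * (g +ℚ d))      ≤⟨ +-monoʳ-≤ g (+-monoˡ-≤ (- (c * (g +ℚ d))) d≤c[g+d]) ⟩
  g +ℚ (c * (g +ℚ d) - c * (g +ℚ d))  ≡⟨ cong (g +ℚ_) (+-inverseʳ (c * (g +ℚ d))) ⟩
  g +ℚ 0ℚ                      ≡⟨ +-identityʳ g ⟩
  g                            ∎
  where
  open ≤-Reasoning
  expand : ∀ g d c → (1ℚ - c) * (g +ℚ d) ≡ g +ℚ (d - c * (g +ℚ d))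
  expand = solve 3 (λ g d c → (con 1ℚ :- c) :* (g :+ d) := g :+ (d :- c :* (g :+ d))) refl

p*[k+k]≤1⇒p≤1 : ∀ {p k} → 0ℚ ≤ℚ p → 1 ≤ k → p * fromℕ (k + k) ≤ℚ 1ℚ → p ≤ℚ 1ℚ
p*[k+k]≤1⇒p≤1 {p} {k} 0≤p 1≤k p[k+k]≤1 = begin
  p                    ≡⟨ *-identityʳ p ⟨
  p * 1ℚ               ≤⟨ *-monoˡ-≤ 0≤p (fromℕ-mono (ℕₚ.≤-trans 1≤k (ℕₚ.m≤m+n k k))) ⟩
  p * fromℕ (k + k)    ≤⟨ p[k+k]≤1 ⟩
  1ℚ                   ∎
  where open ≤-Reasoning

p+x≤t*x : ∀ {p t x} → suc p ≤ t → 1 ≤ x → p + x ≤ t ℕ.* x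
p+x≤t*x {p} {t} {x} p<t 1≤x = begin
  p + x          ≤⟨ ℕₚ.+-monoˡ-≤ x (ℕₚ.m≤m*n p x {{ℕ.>-nonZero 1≤x}}) ⟩
  p ℕ.* x + x    ≡⟨ ℕₚ.+-comm (p ℕ.* x) x ⟩
  suc p ℕ.* x    ≤⟨ ℕₚ.*-monoˡ-≤ x p<t ⟩
  t ℕ.* x        ∎
  where open ℕₚ.≤-Reasoning

module _ {τ α : ℚ} (0<α : 0ℚ < α) (α≤τ : α ≤ℚ τ) where

  private
    instance
      α≢0 : NonZero α
      α≢0 = pos⇒nonZero α {{positive 0<α}}

    0≤α : 0ℚ ≤ℚ α
    0≤α = <⇒≤ 0<α

    α*[τ÷α]≡τ : α * (τ ÷ α) ≡ τ
    α*[τ÷α]≡τ = trans (swap α τ (1/ α)) (trans (cong (τ *_) (*-inverseʳ α)) (*-identityʳ τ))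
      where
      swap : ∀ a b c → a * (b * c) ≡ b * (a * c)
      swap = solve 3 (λ a b c → a :* (b :* c) := b :* (a :* c)) refl

    1≤τ÷α : 1ℚ ≤ℚ τ ÷ α
    1≤τ÷α = *-cancelˡ-≤-pos α {{positive 0<α}}
      (≤-trans (≤-reflexive (*-identityʳ α)) (≤-trans α≤τ (≤-reflexive (sym α*[τ÷α]≡τ))))

  homParam-nonNeg : ∀ t → 0ℚ ≤ℚ homParam τ α 0<α t
  homParam-nonNeg t = *-nonNeg 0≤α (^ℚ-nonNeg t (≤-trans 0≤1 1≤τ÷α))

  τ^[p+x]≤homParam^x*α^p : ∀ {t p x} → suc p ≤ t → 1 ≤ x → τ ^ℚ (p + x) ≤ℚ homParam τ α 0<α t ^ℚ x * α ^ℚ p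
  τ^[p+x]≤homParam^x*α^p {t} {p} {x} p<t 1≤x = begin
    τ ^ℚ (p + x)                              ≡⟨ cong (_^ℚ (p + x)) α*[τ÷α]≡τ ⟨
    (α * y) ^ℚ (p + x)                        ≡⟨ ^ℚ-distribʳ-* α y (p + x) ⟩
    α ^ℚ (p + x) * y ^ℚ (p + x)               ≤⟨ *-monoˡ-≤ (^ℚ-nonNeg (p + x) 0≤α)
                                                   (^ℚ-monoʳ-≤ 1≤τ÷α (p+x≤t*x p<t 1≤x)) ⟩
    α ^ℚ (p + x) * y ^ℚ (t ℕ.* x)             ≡⟨ cong₂ _*_ (^ℚ-distribˡ-+-* α p x) (sym (^ℚ-*-assoc y t x)) ⟩
    (α ^ℚ p * α ^ℚ x) * (y ^ℚ t) ^ℚ x         ≡⟨ rearrange (α ^ℚ p) (α ^ℚ x) ((y ^ℚ t) ^ℚ x) ⟩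
    (α ^ℚ x * (y ^ℚ t) ^ℚ x) * α ^ℚ p         ≡⟨ cong (_* α ^ℚ p) (^ℚ-distribʳ-* α (y ^ℚ t) x) ⟨
    (α * y ^ℚ t) ^ℚ x * α ^ℚ p                ∎
    where
    open ≤-Reasoning
    y : ℚ
    y = τ ÷ α
    rearrange : ∀ a b c → (a * b) * c ≡ (b * c) * a
    rearrange = solve 3 (λ a b c → (a :* b) :* c := (b :* c) :* a) refl

𝟙 : Bool → ℚ
𝟙 true  = 1ℚ
𝟙 false = 0ℚ

𝟙-∧ : ∀ a b → 𝟙 (a ∧ b) ≡ 𝟙 a * 𝟙 b
𝟙-∧ true  b = sym (*-identityˡ (𝟙 b))
𝟙-∧ false b = sym (*-zeroˡ (𝟙 b))

𝟙-nonNeg : ∀ b → 0ℚ ≤ℚ 𝟙 b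
𝟙-nonNeg true  = 0≤1
𝟙-nonNeg false = ≤-refl

∑ : ∀ {n} → (Subset n → ℚ) → ℚ
∑ {zero}  f = f []
∑ {suc n} f = ∑ (λ S → f (inside ∷ S)) +ℚ ∑ (λ S → f (outside ∷ S))

syntax ∑ (λ S → e) = ∑[ S ] e

∑-cong : ∀ {n} {f g : Subset n → ℚ} → (∀ S → f S ≡ g S) → ∑ f ≡ ∑ g
∑-cong {zero}  h = h []
∑-cong {suc n} h = cong₂ _+ℚ_ (∑-cong (λ S → h (inside ∷ S))) (∑-cong (λ S → h (outside ∷ S)))

∑-+ : ∀ {n} (f g : Subset n → ℚ) → ∑[ S ] (f S +ℚ g S) ≡ ∑ f +ℚ ∑ g
∑-+ {zero}  f g = refl
∑-+ {suc n} f g = trans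
  (cong₂ _+ℚ_ (∑-+ (λ S → f (inside ∷ S)) (λ S → g (inside ∷ S)))
              (∑-+ (λ S → f (outside ∷ S)) (λ S → g (outside ∷ S))))
  (interchange (∑ (λ S → f (inside ∷ S))) (∑ (λ S → g (inside ∷ S)))
               (∑ (λ S → f (outside ∷ S))) (∑ (λ S → g (outside ∷ S))))
  where
  interchange : ∀ a b c d → (a +ℚ b) +ℚ (c +ℚ d) ≡ (a +ℚ c) +ℚ (b +ℚ d)
  interchange = solve 4 (λ a b c d → (a :+ b) :+ (c :+ d) := (a :+ c) :+ (b :+ d)) refl

∑-*ˡ : ∀ {n} c (f : Subset n → ℚ) → ∑[ S ] (c * f S) ≡ c * ∑ f
∑-*ˡ {zero}  c f = refl
∑-*ˡ {suc n} c f = trans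
  (cong₂ _+ℚ_ (∑-*ˡ c (λ S → f (inside ∷ S))) (∑-*ˡ c (λ S → f (outside ∷ S))))
  (sym (*-distribˡ-+ c _ _))

∑-0 : ∀ {n} → ∑ {n} (λ _ → 0ℚ) ≡ 0ℚ
∑-0 {n} = trans (∑-*ˡ {n} 0ℚ (λ _ → 0ℚ)) (*-zeroˡ (∑ {n} (λ _ → 0ℚ)))

∑-mono : ∀ {n} {f g : Subset n → ℚ} → (∀ S → f S ≤ℚ g S) → ∑ f ≤ℚ ∑ g
∑-mono {zero}  h = h []
∑-mono {suc n} h = +-mono-≤ (∑-mono (λ S → h (inside ∷ S))) (∑-mono (λ S → h (outside ∷ S)))

∑-nonNeg : ∀ {n} {f : Subset n → ℚ} → (∀ S → 0ℚ ≤ℚ f S) → 0ℚ ≤ℚ ∑ f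
∑-nonNeg {n} h = ≤-trans (≤-reflexive (sym (∑-0 {n}))) (∑-mono h)

∑-comm : ∀ {m n} (h : Subset m → Subset n → ℚ) → ∑[ S ] ∑[ P ] h S P ≡ ∑[ P ] ∑[ S ] h S P
∑-comm {zero}  h = refl
∑-comm {suc m} {n} h = trans
  (cong₂ _+ℚ_ (∑-comm (λ S → h (inside ∷ S))) (∑-comm (λ S → h (outside ∷ S))))
  (sym (∑-+ {n} (λ P → ∑[ S ] h (inside ∷ S) P) (λ P → ∑[ S ] h (outside ∷ S) P)))

term≤∑ : ∀ {n} {f : Subset n → ℚ} → (∀ S → 0ℚ ≤ℚ f S) → ∀ P → f P ≤ℚ ∑ f
term≤∑ {zero}  h []            = ≤-refl
term≤∑ {suc n} {f} h (inside ∷ P) = begin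
  f (inside ∷ P)                                ≤⟨ term≤∑ (λ S → h (inside ∷ S)) P ⟩
  ∑ (λ S → f (inside ∷ S))                      ≡⟨ +-identityʳ _ ⟨
  ∑ (λ S → f (inside ∷ S)) +ℚ 0ℚ                ≤⟨ +-monoʳ-≤ (∑ (λ S → f (inside ∷ S))) (∑-nonNeg (λ S → h (outside ∷ S))) ⟩
  ∑ f                                           ∎
  where open ≤-Reasoning
term≤∑ {suc n} {f} h (outside ∷ P) = begin
  f (outside ∷ P)                               ≤⟨ term≤∑ (λ S → h (outside ∷ S)) P ⟩
  ∑ (λ S → f (outside ∷ S))                     ≡⟨ +-identityˡ _ ⟨
  0ℚ +ℚ ∑ (λ S → f (outside ∷ S))               ≤⟨ +-monoˡ-≤ (∑ (λ S → f (outside ∷ S))) (∑-nonNeg (λ S → h (inside ∷ S))) ⟩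
  ∑ f                                           ∎
  where open ≤-Reasoning

∑-*0 : ∀ {n} (f : Subset n → ℚ) → ∑[ S ] (f S * 0ℚ) ≡ 0ℚ
∑-*0 {n} f = trans (∑-cong (λ S → *-zeroʳ (f S))) (∑-0 {n})

∑-𝟙-∧-false : ∀ {n} (f : Subset n → Bool) → ∑[ S ] 𝟙 (f S ∧ false) ≡ 0ℚ
∑-𝟙-∧-false {n} f = trans (∑-cong (λ S → cong 𝟙 (Bool.∧-zeroʳ (f S)))) (∑-0 {n})

length-filter-map : ∀ {A B : Set} (p : B → Bool) (f : A → B) xs →
  length (filter (λ y → p y Bool.≟ true) (map f xs)) ≡ length (filter (λ x → p (f x) Bool.≟ true) xs)
length-filter-map p f []       = refl
length-filter-map p f (x ∷ xs) with p (f x)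
... | true  = cong suc (length-filter-map p f xs)
... | false = length-filter-map p f xs

∣∣ᶠ-suc : ∀ {n} (H : Family (suc n)) →
  ∣ H ∣ᶠ ≡ ∣ (λ S → H (inside ∷ S)) ∣ᶠ + ∣ (λ S → H (outside ∷ S)) ∣ᶠ
∣∣ᶠ-suc {n} H = begin
  length (filter H? (map (inside ∷_) L ++ map (outside ∷_) L))
    ≡⟨ cong length (filter-++ H? (map (inside ∷_) L) (map (outside ∷_) L)) ⟩
  length (filter H? (map (inside ∷_) L) ++ filter H? (map (outside ∷_) L))
    ≡⟨ length-++ (filter H? (map (inside ∷_) L)) ⟩
  length (filter H? (map (inside ∷_) L)) + length (filter H? (map (outside ∷_) L))
    ≡⟨ cong₂ _+_ (length-filter-map H (inside ∷_) L) (length-filter-map H (outside ∷_) L) ⟩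
  ∣ (λ S → H (inside ∷ S)) ∣ᶠ + ∣ (λ S → H (outside ∷ S)) ∣ᶠ ∎
  where
  open ≡-Reasoning
  L : List (Subset n)
  L = allSubsets n
  H? : (S : Subset (suc n)) → Dec (H S ≡ true)
  H? S = H S Bool.≟ true

fromℕ-∣∣ᶠ : ∀ {n} (H : Family n) → fromℕ ∣ H ∣ᶠ ≡ ∑[ S ] 𝟙 (H S)
fromℕ-∣∣ᶠ {zero} H with H []
... | true  = refl
... | false = refl
fromℕ-∣∣ᶠ {suc n} H = trans (cong fromℕ (∣∣ᶠ-suc H))
  (trans (fromℕ-+ ∣ (λ S → H (inside ∷ S)) ∣ᶠ ∣ (λ S → H (outside ∷ S)) ∣ᶠ)
  (cong₂ _+ℚ_ (fromℕ-∣∣ᶠ (λ S → H (inside ∷ S))) (fromℕ-∣∣ᶠ (λ S → H (outside ∷ S)))))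

∣∣ᶠ-cong : ∀ {n} {H H′ : Family n} → (∀ S → H S ≡ H′ S) → ∣ H ∣ᶠ ≡ ∣ H′ ∣ᶠ
∣∣ᶠ-cong {zero} {H} {H′} h with H [] | H′ [] | h []
... | true  | .true  | refl = refl
... | false | .false | refl = refl
∣∣ᶠ-cong {suc n} {H} {H′} h = begin
  ∣ H ∣ᶠ                                                    ≡⟨ ∣∣ᶠ-suc H ⟩
  ∣ (λ S → H (inside ∷ S)) ∣ᶠ + ∣ (λ S → H (outside ∷ S)) ∣ᶠ
    ≡⟨ cong₂ _+_ (∣∣ᶠ-cong (λ S → h (inside ∷ S))) (∣∣ᶠ-cong (λ S → h (outside ∷ S))) ⟩
  ∣ (λ S → H′ (inside ∷ S)) ∣ᶠ + ∣ (λ S → H′ (outside ∷ S)) ∣ᶠ ≡⟨ ∣∣ᶠ-suc H′ ⟨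
  ∣ H′ ∣ᶠ                                                   ∎
  where open ≡-Reasoning

∣∣ᶠ-mono : ∀ {n} {H H′ : Family n} → H ⊑ H′ → ∣ H ∣ᶠ ≤ ∣ H′ ∣ᶠ
∣∣ᶠ-mono {zero} {H} {H′} h with H [] in e | H′ [] in e′
... | false | _     = ℕ.z≤n
... | true  | true  = ℕₚ.≤-refl
... | true  | false with () ← trans (sym e′) (h [] e)
∣∣ᶠ-mono {suc n} {H} {H′} h rewrite ∣∣ᶠ-suc H | ∣∣ᶠ-suc H′ =
  ℕₚ.+-mono-≤ (∣∣ᶠ-mono (λ S → h (inside ∷ S))) (∣∣ᶠ-mono (λ S → h (outside ∷ S)))

_⊆ᵇ_ : ∀ {n} → Subset n → Subset n → Bool
P ⊆ᵇ S = does (P ⊆? S)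

disjointᵇ : ∀ {n} → Subset n → Subset n → Bool
disjointᵇ []      []      = true
disjointᵇ (s ∷ S) (x ∷ X) = not (s ∧ x) ∧ disjointᵇ S X

any-++ : ∀ {A : Set} (p : A → Bool) xs ys → any p (xs ++ ys) ≡ any p xs ∨ any p ys
any-++ p []       ys = refl
any-++ p (x ∷ xs) ys = trans (cong (p x ∨_) (any-++ p xs ys)) (sym (Bool.∨-assoc (p x) _ _))

any-map : ∀ {A B : Set} (p : B → Bool) (f : A → B) xs → any p (map f xs) ≡ any (λ x → p (f x)) xs
any-map p f []       = refl
any-map p f (x ∷ xs) = cong (p (f x) ∨_) (any-map p f xs)

any-false : ∀ {A : Set} {p : A → Bool} → (∀ x → p x ≡ false) → ∀ xs → any p xs ≡ false
any-false h []       = refl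
any-false h (x ∷ xs) = cong₂ _∨_ (h x) (any-false h xs)

any-allSubsets-suc : ∀ {n} (p : Subset (suc n) → Bool) →
  any p (allSubsets (suc n)) ≡ any (λ S → p (inside ∷ S)) (allSubsets n) ∨ any (λ S → p (outside ∷ S)) (allSubsets n)
any-allSubsets-suc {n} p = trans (any-++ p (map (inside ∷_) (allSubsets n)) (map (outside ∷_) (allSubsets n)))
  (cong₂ _∨_ (any-map p (inside ∷_) (allSubsets n)) (any-map p (outside ∷_) (allSubsets n)))

link-char : ∀ {n} (H : Family n) X S → link H X S ≡ H (S ∪ X) ∧ disjointᵇ S X
link-char {zero} H [] [] with H []
... | true  = refl
... | false = refl
link-char {suc n} H (x ∷ X) (s ∷ S) = trans (any-allSubsets-suc (member x s)) (cases x s)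
  where
  L : List (Subset n)
  L = allSubsets n
  member : Bool → Bool → Subset (suc n) → Bool
  member x s G = H G ∧ (x ∷ X) ⊆ᵇ G ∧ does (≡-dec Bool._≟_ (G ─ (x ∷ X)) (s ∷ S))
  ∧∧false : ∀ a b → a ∧ b ∧ false ≡ false
  ∧∧false true  b = Bool.∧-zeroʳ b
  ∧∧false false b = refl
  cases : ∀ x s → any (λ G → member x s (inside ∷ G)) L ∨ any (λ G → member x s (outside ∷ G)) L
                ≡ H ((s ∨ x) ∷ (S ∪ X)) ∧ not (s ∧ x) ∧ disjointᵇ S X
  cases inside inside = trans
    (cong₂ _∨_ (any-false (λ G → ∧∧false (H (inside ∷ G)) _) L) (any-false (λ G → Bool.∧-zeroʳ (H (outside ∷ G))) L))
    (sym (Bool.∧-zeroʳ (H (inside ∷ (S ∪ X)))))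
  cases inside outside = trans
    (cong₂ _∨_ (link-char (λ G → H (inside ∷ G)) X S) (any-false (λ G → Bool.∧-zeroʳ (H (outside ∷ G))) L))
    (Bool.∨-identityʳ _)
  cases outside inside = trans
    (cong₂ _∨_ (link-char (λ G → H (inside ∷ G)) X S) (any-false (λ G → ∧∧false (H (outside ∷ G)) _) L))
    (Bool.∨-identityʳ _)
  cases outside outside =
    cong₂ _∨_ (any-false (λ G → ∧∧false (H (inside ∷ G)) _) L) (link-char (λ G → H (outside ∷ G)) X S)

link-⊑ : ∀ {n} {F A : Family n} → F ⊑ A → ∀ X → link F X ⊑ link A X
link-⊑ {F = F} {A} F⊑A X S S∈F[X]
  rewrite link-char F X S | link-char A X S
        | F⊑A (S ∪ X) (Bool.∧-conicalˡ _ _ S∈F[X]) = Bool.∧-conicalʳ _ _ S∈F[X]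

disjointᵇ-⊥ : ∀ {n} (S : Subset n) → disjointᵇ S ⊥ ≡ true
disjointᵇ-⊥ []      = refl
disjointᵇ-⊥ (s ∷ S) rewrite Bool.∧-zeroʳ s = disjointᵇ-⊥ S

link-⊥ : ∀ {n} (H : Family n) S → link H ⊥ S ≡ H S
link-⊥ H S rewrite link-char H ⊥ S | ∪-identityʳ S | disjointᵇ-⊥ S = Bool.∧-identityʳ (H S)

∣p∣≡0⇒p≡⊥ : ∀ {n} {p : Subset n} → ∣ p ∣ ≡ 0 → p ≡ ⊥
∣p∣≡0⇒p≡⊥ {p = []}          _ = refl
∣p∣≡0⇒p≡⊥ {p = outside ∷ p} e = cong (outside ∷_) (∣p∣≡0⇒p≡⊥ e)

∣∪∣-disjoint : ∀ {n} (P X : Subset n) → disjointᵇ P X ≡ true → ∣ P ∪ X ∣ ≡ ∣ P ∣ + ∣ X ∣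
∣∪∣-disjoint []            []            _ = refl
∣∪∣-disjoint (outside ∷ P) (outside ∷ X) d = ∣∪∣-disjoint P X d
∣∪∣-disjoint (inside ∷ P)  (outside ∷ X) d = cong suc (∣∪∣-disjoint P X d)
∣∪∣-disjoint (outside ∷ P) (inside ∷ X)  d = trans (cong suc (∣∪∣-disjoint P X d)) (sym (ℕₚ.+-suc ∣ P ∣ ∣ X ∣))

disjointᵇ-∪-link : ∀ {n} (S X P : Subset n) → disjointᵇ P X ≡ true →
  disjointᵇ (S ∪ X) P ∧ disjointᵇ S X ≡ disjointᵇ S (P ∪ X)
disjointᵇ-∪-link []            []            []            _ = refl
disjointᵇ-∪-link (outside ∷ S) (outside ∷ X) (outside ∷ P) d = disjointᵇ-∪-link S X P d
disjointᵇ-∪-link (outside ∷ S) (outside ∷ X) (inside ∷ P)  d = disjointᵇ-∪-link S X P d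
disjointᵇ-∪-link (outside ∷ S) (inside ∷ X)  (outside ∷ P) d = disjointᵇ-∪-link S X P d
disjointᵇ-∪-link (inside ∷ S)  (outside ∷ X) (outside ∷ P) d = disjointᵇ-∪-link S X P d
disjointᵇ-∪-link (inside ∷ S)  (inside ∷ X)  (outside ∷ P) d = Bool.∧-zeroʳ _
disjointᵇ-∪-link (inside ∷ S)  (outside ∷ X) (inside ∷ P)  d = refl

disjointᵇ-∪ˡ⇒disjointᵇ : ∀ {n} (T X P : Subset n) → disjointᵇ (T ∪ X) P ≡ true → disjointᵇ P X ≡ true
disjointᵇ-∪ˡ⇒disjointᵇ []            []            []            _ = refl
disjointᵇ-∪ˡ⇒disjointᵇ (inside ∷ T)  (outside ∷ X) (outside ∷ P) d = disjointᵇ-∪ˡ⇒disjointᵇ T X P d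
disjointᵇ-∪ˡ⇒disjointᵇ (outside ∷ T) (outside ∷ X) (outside ∷ P) d = disjointᵇ-∪ˡ⇒disjointᵇ T X P d
disjointᵇ-∪ˡ⇒disjointᵇ (inside ∷ T)  (inside ∷ X)  (outside ∷ P) d = disjointᵇ-∪ˡ⇒disjointᵇ T X P d
disjointᵇ-∪ˡ⇒disjointᵇ (outside ∷ T) (inside ∷ X)  (outside ∷ P) d = disjointᵇ-∪ˡ⇒disjointᵇ T X P d
disjointᵇ-∪ˡ⇒disjointᵇ (outside ∷ T) (outside ∷ X) (inside ∷ P)  d = disjointᵇ-∪ˡ⇒disjointᵇ T X P d

link-link : ∀ {n} (H : Family n) P X → disjointᵇ P X ≡ true → ∀ S → link (link H P) X S ≡ link H (P ∪ X) S
link-link H P X d S = begin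
  link (link H P) X S                                      ≡⟨ link-char (link H P) X S ⟩
  link H P (S ∪ X) ∧ disjointᵇ S X                         ≡⟨ cong (_∧ disjointᵇ S X) (link-char H P (S ∪ X)) ⟩
  (H ((S ∪ X) ∪ P) ∧ disjointᵇ (S ∪ X) P) ∧ disjointᵇ S X  ≡⟨ Bool.∧-assoc (H ((S ∪ X) ∪ P)) _ _ ⟩
  H ((S ∪ X) ∪ P) ∧ disjointᵇ (S ∪ X) P ∧ disjointᵇ S X    ≡⟨ cong₂ _∧_ (cong H reassociate) (disjointᵇ-∪-link S X P d) ⟩
  H (S ∪ (P ∪ X)) ∧ disjointᵇ S (P ∪ X)                    ≡⟨ link-char H (P ∪ X) S ⟨
  link H (P ∪ X) S                                         ∎
  where
  open ≡-Reasoning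
  reassociate : (S ∪ X) ∪ P ≡ S ∪ (P ∪ X)
  reassociate = trans (∪-assoc S X P) (cong (S ∪_) (∪-comm X P))

link-link⇒disjointᵇ : ∀ {n} (H : Family n) P X U → link (link H P) X U ≡ true → disjointᵇ P X ≡ true
link-link⇒disjointᵇ H P X U U∈H[P][X] = disjointᵇ-∪ˡ⇒disjointᵇ U X P (Bool.∧-conicalʳ _ _ U∪X∈H[P])
  where
  U∪X∈H[P] : H ((U ∪ X) ∪ P) ∧ disjointᵇ (U ∪ X) P ≡ true
  U∪X∈H[P] = trans (sym (link-char H P (U ∪ X)))
                   (Bool.∧-conicalˡ _ _ (trans (sym (link-char (link H P) X U)) U∈H[P][X]))

uniform-link⇒∣X∣≤k : ∀ {n k} {H : Family n} → Uniform k H → ∀ X U → link H X U ≡ true → ∣ X ∣ ≤ k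
uniform-link⇒∣X∣≤k {H = H} uniform X U U∈H[X] = ℕₚ.≤-trans (∣q∣≤∣p∪q∣ U X)
  (ℕₚ.≤-reflexive (uniform (U ∪ X) (Bool.∧-conicalˡ _ _ (trans (sym (link-char H X U)) U∈H[X]))))

-- S ↦ S ∪ X is a bijection from the sets disjoint from X onto the supersets of X.
∑-translate : ∀ {n} (H : Family n) X → ∑[ S ] 𝟙 (H (S ∪ X) ∧ disjointᵇ S X) ≡ ∑[ S ] 𝟙 (H S ∧ X ⊆ᵇ S)
∑-translate {zero} H [] = refl
∑-translate {suc n} H (inside ∷ X) = begin
  ∑[ S ] 𝟙 (H (inside ∷ (S ∪ X)) ∧ false) +ℚ ∑[ S ] 𝟙 (H (inside ∷ (S ∪ X)) ∧ disjointᵇ S X)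
    ≡⟨ cong₂ _+ℚ_ (∑-𝟙-∧-false (λ S → H (inside ∷ (S ∪ X)))) (∑-translate (λ S → H (inside ∷ S)) X) ⟩
  0ℚ +ℚ ∑[ S ] 𝟙 (H (inside ∷ S) ∧ X ⊆ᵇ S)
    ≡⟨ +-identityˡ _ ⟩
  ∑[ S ] 𝟙 (H (inside ∷ S) ∧ X ⊆ᵇ S)
    ≡⟨ +-identityʳ _ ⟨
  ∑[ S ] 𝟙 (H (inside ∷ S) ∧ X ⊆ᵇ S) +ℚ 0ℚ
    ≡⟨ cong (∑[ S ] 𝟙 (H (inside ∷ S) ∧ X ⊆ᵇ S) +ℚ_) (∑-𝟙-∧-false (λ S → H (outside ∷ S))) ⟨
  ∑[ S ] 𝟙 (H (inside ∷ S) ∧ X ⊆ᵇ S) +ℚ ∑[ S ] 𝟙 (H (outside ∷ S) ∧ false) ∎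
  where open ≡-Reasoning
∑-translate H (outside ∷ X) =
  cong₂ _+ℚ_ (∑-translate (λ S → H (inside ∷ S)) X) (∑-translate (λ S → H (outside ∷ S)) X)

fromℕ-∣link∣ᶠ : ∀ {n} (H : Family n) X → fromℕ ∣ link H X ∣ᶠ ≡ ∑[ S ] 𝟙 (H S ∧ X ⊆ᵇ S)
fromℕ-∣link∣ᶠ H X = trans (fromℕ-∣∣ᶠ (link H X))
  (trans (∑-cong (λ S → cong 𝟙 (link-char H X S))) (∑-translate H X))

weighted-∑-∣link∣ᶠ : ∀ {n} (w : Subset n → ℚ) (H : Family n) →
  ∑[ P ] (w P * fromℕ ∣ link H P ∣ᶠ) ≡ ∑[ S ] (𝟙 (H S) * ∑[ P ] (w P * 𝟙 (P ⊆ᵇ S)))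
weighted-∑-∣link∣ᶠ w H = begin
  ∑[ P ] (w P * fromℕ ∣ link H P ∣ᶠ)          ≡⟨ ∑-cong (λ P → cong (w P *_) (fromℕ-∣link∣ᶠ H P)) ⟩
  ∑[ P ] (w P * ∑[ S ] 𝟙 (H S ∧ P ⊆ᵇ S))      ≡⟨ ∑-cong (λ P → ∑-*ˡ (w P) (λ S → 𝟙 (H S ∧ P ⊆ᵇ S))) ⟨
  ∑[ P ] ∑[ S ] (w P * 𝟙 (H S ∧ P ⊆ᵇ S))      ≡⟨ ∑-comm (λ P S → w P * 𝟙 (H S ∧ P ⊆ᵇ S)) ⟩
  ∑[ S ] ∑[ P ] (w P * 𝟙 (H S ∧ P ⊆ᵇ S))      ≡⟨ ∑-cong (λ S → ∑-cong (λ P → split (w P) (H S) (P ⊆ᵇ S))) ⟩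
  ∑[ S ] ∑[ P ] (𝟙 (H S) * (w P * 𝟙 (P ⊆ᵇ S))) ≡⟨ ∑-cong (λ S → ∑-*ˡ (𝟙 (H S)) (λ P → w P * 𝟙 (P ⊆ᵇ S))) ⟩
  ∑[ S ] (𝟙 (H S) * ∑[ P ] (w P * 𝟙 (P ⊆ᵇ S))) ∎
  where
  open ≡-Reasoning
  swap : ∀ a b c → a * (b * c) ≡ b * (a * c)
  swap = solve 3 (λ a b c → a :* (b :* c) := b :* (a :* c)) refl
  split : ∀ c a b → c * 𝟙 (a ∧ b) ≡ 𝟙 a * (c * 𝟙 b)
  split c a b = trans (cong (c *_) (𝟙-∧ a b)) (swap c (𝟙 a) (𝟙 b))

∑-^-⊆ : ∀ {n} α (S : Subset n) → ∑[ P ] (α ^ℚ ∣ P ∣ * 𝟙 (P ⊆ᵇ S)) ≡ (1ℚ +ℚ α) ^ℚ ∣ S ∣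
∑-^-⊆ α [] = refl
∑-^-⊆ α (inside ∷ S) = begin
  ∑[ P ] ((α * α ^ℚ ∣ P ∣) * 𝟙 (P ⊆ᵇ S)) +ℚ V
    ≡⟨ cong (_+ℚ V) (trans (∑-cong (λ P → *-assoc α (α ^ℚ ∣ P ∣) (𝟙 (P ⊆ᵇ S)))) (∑-*ˡ α (λ P → α ^ℚ ∣ P ∣ * 𝟙 (P ⊆ᵇ S)))) ⟩
  α * V +ℚ V
    ≡⟨ cong (λ v → α * v +ℚ v) (∑-^-⊆ α S) ⟩
  α * (1ℚ +ℚ α) ^ℚ ∣ S ∣ +ℚ (1ℚ +ℚ α) ^ℚ ∣ S ∣
    ≡⟨ factor α ((1ℚ +ℚ α) ^ℚ ∣ S ∣) ⟩
  (1ℚ +ℚ α) * (1ℚ +ℚ α) ^ℚ ∣ S ∣ ∎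
  where
  open ≡-Reasoning
  V : ℚ
  V = ∑[ P ] (α ^ℚ ∣ P ∣ * 𝟙 (P ⊆ᵇ S))
  factor : ∀ a v → a * v +ℚ v ≡ (1ℚ +ℚ a) * v
  factor = solve 2 (λ a v → a :* v :+ v := (con 1ℚ :+ a) :* v) refl
∑-^-⊆ {suc n} α (outside ∷ S) = trans
  (cong (_+ℚ ∑[ P ] (α ^ℚ ∣ P ∣ * 𝟙 (P ⊆ᵇ S))) (∑-*0 {n} (λ P → α * α ^ℚ ∣ P ∣)))
  (trans (+-identityˡ (∑[ P ] (α ^ℚ ∣ P ∣ * 𝟙 (P ⊆ᵇ S)))) (∑-^-⊆ α S))

-- The empty set is never bad; dropping its weight is what turns (1+α)^k into (1+α)^k − 1.
nonemptyWeight : ℚ → ℕ → ℚ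
nonemptyWeight α zero    = 0ℚ
nonemptyWeight α (suc m) = α ^ℚ suc m

nonemptyWeight-nonNeg : ∀ {α} m → 0ℚ ≤ℚ α → 0ℚ ≤ℚ nonemptyWeight α m
nonemptyWeight-nonNeg zero    0≤α = ≤-refl
nonemptyWeight-nonNeg (suc m) 0≤α = ^ℚ-nonNeg (suc m) 0≤α

∑-nonemptyWeight-⊆ : ∀ {n} α (S : Subset n) →
  ∑[ P ] (nonemptyWeight α ∣ P ∣ * 𝟙 (P ⊆ᵇ S)) ≡ (1ℚ +ℚ α) ^ℚ ∣ S ∣ - 1ℚ
∑-nonemptyWeight-⊆ α [] = refl
∑-nonemptyWeight-⊆ α (inside ∷ S) = begin
  ∑[ P ] ((α * α ^ℚ ∣ P ∣) * 𝟙 (P ⊆ᵇ S)) +ℚ W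
    ≡⟨ cong (_+ℚ W) (trans (∑-cong (λ P → *-assoc α (α ^ℚ ∣ P ∣) (𝟙 (P ⊆ᵇ S)))) (∑-*ˡ α (λ P → α ^ℚ ∣ P ∣ * 𝟙 (P ⊆ᵇ S)))) ⟩
  α * ∑[ P ] (α ^ℚ ∣ P ∣ * 𝟙 (P ⊆ᵇ S)) +ℚ W
    ≡⟨ cong₂ (λ v w → α * v +ℚ w) (∑-^-⊆ α S) (∑-nonemptyWeight-⊆ α S) ⟩
  α * (1ℚ +ℚ α) ^ℚ ∣ S ∣ +ℚ ((1ℚ +ℚ α) ^ℚ ∣ S ∣ - 1ℚ)
    ≡⟨ factor α ((1ℚ +ℚ α) ^ℚ ∣ S ∣) ⟩
  (1ℚ +ℚ α) * (1ℚ +ℚ α) ^ℚ ∣ S ∣ - 1ℚ ∎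
  where
  open ≡-Reasoning
  W : ℚ
  W = ∑[ P ] (nonemptyWeight α ∣ P ∣ * 𝟙 (P ⊆ᵇ S))
  factor : ∀ a v → a * v +ℚ (v - 1ℚ) ≡ (1ℚ +ℚ a) * v - 1ℚ
  factor = solve 2 (λ a v → a :* v :+ (v :- con 1ℚ) := (con 1ℚ :+ a) :* v :- con 1ℚ) refl
∑-nonemptyWeight-⊆ {suc n} α (outside ∷ S) = trans
  (cong (_+ℚ ∑[ P ] (nonemptyWeight α ∣ P ∣ * 𝟙 (P ⊆ᵇ S))) (∑-*0 {n} (λ P → α * α ^ℚ ∣ P ∣)))
  (trans (+-identityˡ (∑[ P ] (nonemptyWeight α ∣ P ∣ * 𝟙 (P ⊆ᵇ S)))) (∑-nonemptyWeight-⊆ α S))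

∑-nonemptyWeight-∣link∣ᶠ : ∀ {n k} α (H : Family n) → Uniform k H →
  ∑[ P ] (nonemptyWeight α ∣ P ∣ * fromℕ ∣ link H P ∣ᶠ) ≡ fromℕ ∣ H ∣ᶠ * ((1ℚ +ℚ α) ^ℚ k - 1ℚ)
∑-nonemptyWeight-∣link∣ᶠ {k = k} α H uniform = begin
  ∑[ P ] (nonemptyWeight α ∣ P ∣ * fromℕ ∣ link H P ∣ᶠ)            ≡⟨ weighted-∑-∣link∣ᶠ (λ P → nonemptyWeight α ∣ P ∣) H ⟩
  ∑[ S ] (𝟙 (H S) * ∑[ P ] (nonemptyWeight α ∣ P ∣ * 𝟙 (P ⊆ᵇ S)))  ≡⟨ ∑-cong (λ S → cong (𝟙 (H S) *_) (∑-nonemptyWeight-⊆ α S)) ⟩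
  ∑[ S ] (𝟙 (H S) * ((1ℚ +ℚ α) ^ℚ ∣ S ∣ - 1ℚ))                    ≡⟨ ∑-cong pointwise ⟩
  ∑[ S ] (E * 𝟙 (H S))                                             ≡⟨ ∑-*ˡ E (λ S → 𝟙 (H S)) ⟩
  E * ∑[ S ] 𝟙 (H S)                                               ≡⟨ cong (E *_) (fromℕ-∣∣ᶠ H) ⟨
  E * fromℕ ∣ H ∣ᶠ                                                 ≡⟨ *-comm E (fromℕ ∣ H ∣ᶠ) ⟩
  fromℕ ∣ H ∣ᶠ * E                                                 ∎
  where
  open ≡-Reasoning
  E : ℚ
  E = (1ℚ +ℚ α) ^ℚ k - 1ℚ
  pointwise : ∀ S → 𝟙 (H S) * ((1ℚ +ℚ α) ^ℚ ∣ S ∣ - 1ℚ) ≡ E * 𝟙 (H S)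
  pointwise S with H S in e
  ... | true  rewrite uniform S e = *-comm 1ℚ E
  ... | false = trans (*-zeroˡ ((1ℚ +ℚ α) ^ℚ ∣ S ∣ - 1ℚ)) (sym (*-zeroʳ E))

union-bound : ∀ {n} {B : Subset n → Set} (B? : Decidable B) (H : Family n) →
  ∑[ S ] 𝟙 (H S ∧ does (anySubset? (λ P → B? P ×-dec P ⊆? S)))
    ≤ℚ ∑[ P ] (𝟙 (does (B? P)) * fromℕ ∣ link H P ∣ᶠ)
union-bound B? H = begin
  ∑[ S ] 𝟙 (H S ∧ does (anySubset? (λ P → B? P ×-dec P ⊆? S)))     ≤⟨ ∑-mono pointwise ⟩
  ∑[ S ] (𝟙 (H S) * ∑[ P ] (𝟙 (does (B? P)) * 𝟙 (P ⊆ᵇ S)))         ≡⟨ weighted-∑-∣link∣ᶠ (λ P → 𝟙 (does (B? P))) H ⟨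
  ∑[ P ] (𝟙 (does (B? P)) * fromℕ ∣ link H P ∣ᶠ)                    ∎
  where
  open ≤-Reasoning
  covering : ∀ S → ℚ
  covering S = ∑[ P ] (𝟙 (does (B? P)) * 𝟙 (P ⊆ᵇ S))
  covering-nonNeg : ∀ S P → 0ℚ ≤ℚ 𝟙 (does (B? P)) * 𝟙 (P ⊆ᵇ S)
  covering-nonNeg S P = *-nonNeg (𝟙-nonNeg (does (B? P))) (𝟙-nonNeg (P ⊆ᵇ S))
  pointwise : ∀ S → 𝟙 (H S ∧ does (anySubset? (λ P → B? P ×-dec P ⊆? S))) ≤ℚ 𝟙 (H S) * covering S
  pointwise S with H S | anySubset? (λ P → B? P ×-dec P ⊆? S)
  ... | false | _ = ≤-reflexive (sym (*-zeroˡ (covering S)))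
  ... | true  | no _ = ≤-trans (∑-nonNeg (covering-nonNeg S)) (≤-reflexive (sym (*-identityˡ (covering S))))
  ... | true  | yes (P , BP , P⊆S) = begin
    1ℚ                                           ≡⟨ cong₂ (λ b c → 𝟙 b * 𝟙 c) (dec-true (B? P) BP) (dec-true (P ⊆? S) P⊆S) ⟨
    𝟙 (does (B? P)) * 𝟙 (P ⊆ᵇ S)                 ≤⟨ term≤∑ (covering-nonNeg S) P ⟩
    covering S                                   ≡⟨ *-identityˡ (covering S) ⟨
    1ℚ * covering S                              ∎

module Cleaning {n : ℕ} (A F : Family n) (τ α : ℚ) (t : ℕ) where

  r : ℚ
  r = ∣ F ∣ᶠ ÷ℕ ∣ A ∣ᶠ

  relativeDensity : Subset n → ℚ
  relativeDensity P = ∣ link F P ∣ᶠ ÷ℕ ∣ link A P ∣ᶠ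

  Bad : Subset n → Set
  Bad P = ∣ P ∣ ≤ t ∸ 1 × relativeDensity P < α ^ℚ ∣ P ∣ * r

  bad? : Decidable Bad
  bad? P = ∣ P ∣ ℕ.≤? t ∸ 1 ×-dec relativeDensity P <? α ^ℚ ∣ P ∣ * r

  spoilt? : (S : Subset n) → Dec (∃ λ P → Bad P × P ⊆ S)
  spoilt? S = anySubset? (λ P → bad? P ×-dec P ⊆? S)

  cleaned discarded : Family n
  cleaned   S = F S ∧ not (does (spoilt? S))
  discarded S = F S ∧ does (spoilt? S)

  cleaned⊑F : cleaned ⊑ F
  cleaned⊑F S = Bool.∧-conicalˡ (F S) _

  ∣F∣≡∣cleaned∣+∣discarded∣ : fromℕ ∣ F ∣ᶠ ≡ fromℕ ∣ cleaned ∣ᶠ +ℚ fromℕ ∣ discarded ∣ᶠ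
  ∣F∣≡∣cleaned∣+∣discarded∣ = begin
    fromℕ ∣ F ∣ᶠ                                      ≡⟨ fromℕ-∣∣ᶠ F ⟩
    ∑[ S ] 𝟙 (F S)                                    ≡⟨ ∑-cong (λ S → split (F S) (does (spoilt? S))) ⟩
    ∑[ S ] (𝟙 (cleaned S) +ℚ 𝟙 (discarded S))         ≡⟨ ∑-+ (λ S → 𝟙 (cleaned S)) (λ S → 𝟙 (discarded S)) ⟩
    ∑[ S ] 𝟙 (cleaned S) +ℚ ∑[ S ] 𝟙 (discarded S)    ≡⟨ cong₂ _+ℚ_ (fromℕ-∣∣ᶠ cleaned) (fromℕ-∣∣ᶠ discarded) ⟨
    fromℕ ∣ cleaned ∣ᶠ +ℚ fromℕ ∣ discarded ∣ᶠ        ∎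
    where
    open ≡-Reasoning
    split : ∀ a b → 𝟙 a ≡ 𝟙 (a ∧ not b) +ℚ 𝟙 (a ∧ b)
    split true  true  = refl
    split true  false = refl
    split false _     = refl

  relativeDensity-⊥ : relativeDensity ⊥ ≡ r
  relativeDensity-⊥ = cong₂ _÷ℕ_ (∣∣ᶠ-cong (link-⊥ F)) (∣∣ᶠ-cong (link-⊥ A))

  bad⇒nonemptyWeight≡^ : ∀ {P} → Bad P → nonemptyWeight α ∣ P ∣ ≡ α ^ℚ ∣ P ∣
  bad⇒nonemptyWeight≡^ {P} (_ , ρ<α^r) with ∣ P ∣ in ∣P∣≡m
  ... | suc _ = refl
  ... | zero  = ⊥-elim (<-irrefl (trans ρ≡r (sym (*-identityˡ r))) ρ<α^r)
    where
    ρ≡r : relativeDensity P ≡ r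
    ρ≡r = trans (cong relativeDensity (∣p∣≡0⇒p≡⊥ ∣P∣≡m)) relativeDensity-⊥

  ∣discarded∣≤ : F ⊑ A → 0ℚ ≤ℚ α →
    fromℕ ∣ discarded ∣ᶠ ≤ℚ r * ∑[ P ] (nonemptyWeight α ∣ P ∣ * fromℕ ∣ link A P ∣ᶠ)
  ∣discarded∣≤ F⊑A 0≤α = begin
    fromℕ ∣ discarded ∣ᶠ                                         ≡⟨ fromℕ-∣∣ᶠ discarded ⟩
    ∑[ S ] 𝟙 (discarded S)                                       ≤⟨ union-bound bad? F ⟩
    ∑[ P ] (𝟙 (does (bad? P)) * fromℕ ∣ link F P ∣ᶠ)             ≤⟨ ∑-mono pointwise ⟩
    ∑[ P ] (r * (nonemptyWeight α ∣ P ∣ * fromℕ ∣ link A P ∣ᶠ))  ≡⟨ ∑-*ˡ r (λ P → nonemptyWeight α ∣ P ∣ * fromℕ ∣ link A P ∣ᶠ) ⟩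
    r * ∑[ P ] (nonemptyWeight α ∣ P ∣ * fromℕ ∣ link A P ∣ᶠ)    ∎
    where
    open ≤-Reasoning
    pointwise : ∀ P → 𝟙 (does (bad? P)) * fromℕ ∣ link F P ∣ᶠ ≤ℚ r * (nonemptyWeight α ∣ P ∣ * fromℕ ∣ link A P ∣ᶠ)
    pointwise P = bound (bad? P)
      where
      bound : (bad : Dec (Bad P)) → 𝟙 (does bad) * fromℕ ∣ link F P ∣ᶠ ≤ℚ r * (nonemptyWeight α ∣ P ∣ * fromℕ ∣ link A P ∣ᶠ)
      bound (no _) = ≤-trans (≤-reflexive (*-zeroˡ (fromℕ ∣ link F P ∣ᶠ)))
                     (*-nonNeg (÷ℕ-nonNeg ∣ F ∣ᶠ ∣ A ∣ᶠ) (*-nonNeg (nonemptyWeight-nonNeg ∣ P ∣ 0≤α) (fromℕ-nonNeg ∣ link A P ∣ᶠ)))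
      bound (yes bad@(_ , ρ<α^r)) = begin
        1ℚ * fromℕ ∣ link F P ∣ᶠ                           ≡⟨ *-identityˡ (fromℕ ∣ link F P ∣ᶠ) ⟩
        fromℕ ∣ link F P ∣ᶠ                                 ≡⟨ ÷ℕ-* (∣∣ᶠ-mono (link-⊑ F⊑A P)) ⟨
        relativeDensity P * fromℕ ∣ link A P ∣ᶠ            ≤⟨ *-monoʳ-≤ (fromℕ-nonNeg ∣ link A P ∣ᶠ) (<⇒≤ ρ<α^r) ⟩
        (α ^ℚ ∣ P ∣ * r) * fromℕ ∣ link A P ∣ᶠ              ≡⟨ rearrange (α ^ℚ ∣ P ∣) r (fromℕ ∣ link A P ∣ᶠ) ⟩
        r * (α ^ℚ ∣ P ∣ * fromℕ ∣ link A P ∣ᶠ)              ≡⟨ cong (λ w → r * (w * fromℕ ∣ link A P ∣ᶠ)) (bad⇒nonemptyWeight≡^ bad) ⟨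
        r * (nonemptyWeight α ∣ P ∣ * fromℕ ∣ link A P ∣ᶠ)  ∎
        where
        rearrange : ∀ a b c → (a * b) * c ≡ b * (a * c)
        rearrange = solve 3 (λ a b c → (a :* b) :* c := b :* (a :* c)) refl

  cleaned-large : ∀ {k} → Uniform k A → F ⊑ A → 0ℚ ≤ℚ α → α * fromℕ (k + k) ≤ℚ 1ℚ →
    (1ℚ - α * fromℕ (k + k)) * fromℕ ∣ F ∣ᶠ ≤ℚ fromℕ ∣ cleaned ∣ᶠ
  cleaned-large {k} uniform F⊑A 0≤α 2kα≤1 = begin
    (1ℚ - c) * fromℕ ∣ F ∣ᶠ                                    ≡⟨ cong ((1ℚ - c) *_) ∣F∣≡∣cleaned∣+∣discarded∣ ⟩
    (1ℚ - c) * (fromℕ ∣ cleaned ∣ᶠ +ℚ fromℕ ∣ discarded ∣ᶠ)    ≤⟨ [1-c]*[g+d]≤g {c = c} ∣discarded∣≤c∣F∣ ⟩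
    fromℕ ∣ cleaned ∣ᶠ                                         ∎
    where
    open ≤-Reasoning
    c E : ℚ
    c = α * fromℕ (k + k)
    E = (1ℚ +ℚ α) ^ℚ k - 1ℚ
    E≤c : E ≤ℚ c
    E≤c = ≤-trans (+-monoˡ-≤ (- 1ℚ) ([1+x]^k≤1+x*[k+k] k 0≤α 2kα≤1)) (≤-reflexive (cancel c))
      where
      cancel : ∀ c → (1ℚ +ℚ c) - 1ℚ ≡ c
      cancel = solve 1 (λ c → (con 1ℚ :+ c) :- con 1ℚ := c) refl
    ∣discarded∣≤c∣F∣ : fromℕ ∣ discarded ∣ᶠ ≤ℚ c * (fromℕ ∣ cleaned ∣ᶠ +ℚ fromℕ ∣ discarded ∣ᶠ)
    ∣discarded∣≤c∣F∣ = begin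
      fromℕ ∣ discarded ∣ᶠ                                        ≤⟨ ∣discarded∣≤ F⊑A 0≤α ⟩
      r * ∑[ P ] (nonemptyWeight α ∣ P ∣ * fromℕ ∣ link A P ∣ᶠ)   ≡⟨ cong (r *_) (∑-nonemptyWeight-∣link∣ᶠ α A uniform) ⟩
      r * (fromℕ ∣ A ∣ᶠ * E)                                      ≡⟨ *-assoc r (fromℕ ∣ A ∣ᶠ) E ⟨
      (r * fromℕ ∣ A ∣ᶠ) * E                                      ≡⟨ cong (_* E) (÷ℕ-* (∣∣ᶠ-mono F⊑A)) ⟩
      fromℕ ∣ F ∣ᶠ * E                                            ≤⟨ *-monoˡ-≤ (fromℕ-nonNeg ∣ F ∣ᶠ) E≤c ⟩
      fromℕ ∣ F ∣ᶠ * c                                            ≡⟨ *-comm (fromℕ ∣ F ∣ᶠ) c ⟩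
      c * fromℕ ∣ F ∣ᶠ                                            ≡⟨ cong (c *_) ∣F∣≡∣cleaned∣+∣discarded∣ ⟩
      c * (fromℕ ∣ cleaned ∣ᶠ +ℚ fromℕ ∣ discarded ∣ᶠ)            ∎

  cleaned-link⇒¬Bad : ∀ P → NonemptyF (link cleaned P) → ¬ Bad P
  cleaned-link⇒¬Bad P (T , T∈cleaned[P]) bad = unspoilt (spoilt? (T ∪ P)) T∪P-kept (P , bad , q⊆p∪q T P)
    where
    unspoilt : ∀ {S : Set} (s? : Dec S) → not (does s?) ≡ true → ¬ S
    unspoilt (no ¬s) _ = ¬s
    unspoilt (yes _) ()
    T∪P-kept : not (does (spoilt? (T ∪ P))) ≡ true
    T∪P-kept = Bool.∧-conicalʳ (F (T ∪ P)) _
      (Bool.∧-conicalˡ (cleaned (T ∪ P)) _ (trans (sym (link-char cleaned P T)) T∈cleaned[P]))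

  module _ {k} (uniform : Uniform k A) (1≤t : 1 ≤ t) (1≤τ : 1ℚ ≤ℚ τ) (0<α : 0ℚ < α)
           (2kα≤1 : α * fromℕ (k + k) ≤ℚ 1ℚ) (homogeneous : Homogeneous τ A F) where

    relativeDensity-∪≤ : ∀ P X → ∣ P ∣ ≤ t ∸ 1 → ¬ Bad P → disjointᵇ P X ≡ true → NonemptyF (link A (P ∪ X)) →
      relativeDensity (P ∪ X) ≤ℚ homParam τ α 0<α t ^ℚ ∣ X ∣ * relativeDensity P
    relativeDensity-∪≤ P X ∣P∣≤t-1 ¬bad disjoint (U , U∈A[P∪X]) with ∣ X ∣ in ∣X∣≡m
    ... | zero = begin
      relativeDensity (P ∪ X)   ≡⟨ cong (λ Y → relativeDensity (P ∪ Y)) (∣p∣≡0⇒p≡⊥ ∣X∣≡m) ⟩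
      relativeDensity (P ∪ ⊥)   ≡⟨ cong relativeDensity (∪-identityʳ P) ⟩
      relativeDensity P         ≡⟨ *-identityˡ (relativeDensity P) ⟨
      1ℚ * relativeDensity P    ∎
      where open ≤-Reasoning
    ... | suc m = begin
      relativeDensity (P ∪ X)                ≤⟨ homogeneous (P ∪ X) (U , U∈A[P∪X]) ⟩
      τ ^ℚ ∣ P ∪ X ∣ * r                     ≡⟨ cong (λ j → τ ^ℚ j * r) ∣P∪X∣≡∣P∣+suc[m] ⟩
      τ ^ℚ (∣ P ∣ + suc m) * r               ≤⟨ *-monoʳ-≤ (÷ℕ-nonNeg ∣ F ∣ᶠ ∣ A ∣ᶠ)
                                                  (τ^[p+x]≤homParam^x*α^p 0<α α≤τ ∣P∣<t (ℕ.s≤s ℕ.z≤n)) ⟩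
      (β ^ℚ suc m * α ^ℚ ∣ P ∣) * r          ≡⟨ *-assoc (β ^ℚ suc m) (α ^ℚ ∣ P ∣) r ⟩
      β ^ℚ suc m * (α ^ℚ ∣ P ∣ * r)          ≤⟨ *-monoˡ-≤ (^ℚ-nonNeg (suc m) (homParam-nonNeg 0<α α≤τ t))
                                                  (≮⇒≥ (λ ρ<α^r → ¬bad (∣P∣≤t-1 , ρ<α^r))) ⟩
      β ^ℚ suc m * relativeDensity P         ∎
      where
      open ≤-Reasoning
      β : ℚ
      β = homParam τ α 0<α t
      ∣P∪X∣≡∣P∣+suc[m] : ∣ P ∪ X ∣ ≡ ∣ P ∣ + suc m
      ∣P∪X∣≡∣P∣+suc[m] = trans (∣∪∣-disjoint P X disjoint) (cong (λ j → ∣ P ∣ + j) ∣X∣≡m)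
      ∣P∣<t : suc ∣ P ∣ ≤ t
      ∣P∣<t = subst (_≤ t) (ℕₚ.+-comm ∣ P ∣ 1) (ℕₚ.m≤o∸n⇒m+n≤o ∣ P ∣ 1≤t ∣P∣≤t-1)
      1≤k : 1 ≤ k
      1≤k = ℕₚ.≤-trans (subst (1 ≤_) (sym ∣X∣≡m) (ℕ.s≤s ℕ.z≤n))
                       (ℕₚ.≤-trans (∣q∣≤∣p∪q∣ P X) (uniform-link⇒∣X∣≤k uniform (P ∪ X) U U∈A[P∪X]))
      α≤τ : α ≤ℚ τ
      α≤τ = ≤-trans (p*[k+k]≤1⇒p≤1 (<⇒≤ 0<α) 1≤k 2kα≤1) 1≤τ

    cleaned-homogeneous : ∀ P → ∣ P ∣ ≤ t ∸ 1 → NonemptyF (link cleaned P) →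
      Homogeneous (homParam τ α 0<α t) (link A P) (link F P)
    cleaned-homogeneous P ∣P∣≤t-1 nonempty X (U , U∈A[P][X]) = begin
      ∣ link (link F P) X ∣ᶠ ÷ℕ ∣ link (link A P) X ∣ᶠ
        ≡⟨ cong₂ _÷ℕ_ (∣∣ᶠ-cong (link-link F P X disjoint)) (∣∣ᶠ-cong (link-link A P X disjoint)) ⟩
      relativeDensity (P ∪ X)
        ≤⟨ relativeDensity-∪≤ P X ∣P∣≤t-1 (cleaned-link⇒¬Bad P nonempty) disjoint (U , U∈A[P∪X]) ⟩
      homParam τ α 0<α t ^ℚ ∣ X ∣ * relativeDensity P ∎
      where
      open ≤-Reasoning
      disjoint : disjointᵇ P X ≡ true
      disjoint = link-link⇒disjointᵇ A P X U U∈A[P][X]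
      U∈A[P∪X] : link A (P ∪ X) U ≡ true
      U∈A[P∪X] = trans (sym (link-link A P X disjoint U)) U∈A[P][X]

lemma10 : (n k t : ℕ) (A F : Family n) (τ : ℚ) →
    Uniform k A → 1 ≤ t → 1ℚ ≤ℚ τ → F ⊑ A → Homogeneous τ A F →
    (α : ℚ) (α>0 : 0ℚ < α) → α * fromℕ (k + k) ≤ℚ 1ℚ →
    Σ (Family n) λ G → G ⊑ F
      × ((1ℚ - α * fromℕ (k + k)) * fromℕ ∣ F ∣ᶠ ≤ℚ fromℕ ∣ G ∣ᶠ)
      × (∀ (P : Subset n) → ∣ P ∣ ≤ t ∸ 1 → NonemptyF (link G P) →
           Homogeneous (homParam τ α α>0 t) (link A P) (link F P))
lemma10 n k t A F τ uniform 1≤t 1≤τ F⊑A homogeneous α 0<α 2kα≤1 =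
  cleaned , cleaned⊑F , cleaned-large uniform F⊑A (<⇒≤ 0<α) 2kα≤1
          , cleaned-homogeneous uniform 1≤t 1≤τ 0<α 2kα≤1 homogeneous
  where open Cleaning A F τ α t
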